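{- Let $n$ be even, let $k$ be an integer with $1\leq k<n/2$, let $K=\{1,\ldots,n/2-k\}$, and let ${\cal P}=\{R_i\}$ be a collection of $k$-subsets of $\{1,\ldots,n\}\setminus K$ such that $|R_i\cap R_j|<k/3$ for all $i\neq j$. Put $S_i=K\cup R_i$. Then for any three distinct indices $i,j,l$, the collection $\{V;S_i,S_j,S_l\}$ with $V=\{1,\ldots,n\}$ is not invertible.
   Context: A collection $\{V;S_1,\ldots,S_m\}$ of subsets of $V$ is called invertible if there is a permutation $\pi$ of $V$ such that $\pi(S_i)\subseteq V\setminus S_i$ for every $i$. -}

module Defs where

open import Data.Nat using (ℕ; _∸_; _<ᵇ_)
open import Data.Fin using (Fin; toℕ)
open import Data.Fin.Subset using (Subset; _∈_; _∉_)
open import Data.Fin.Permutation using (Permutation′; _⟨$⟩ʳ_)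
open import Data.Vec using (Vec; tabulate)
open import Data.List using (List)
open import Data.List.Relation.Unary.All using (All)
open import Data.Product using (Σ)

MapsIntoComplement : {n : ℕ} → Permutation′ n → Subset n → Set
MapsIntoComplement π S = ∀ x → x ∈ S → (π ⟨$⟩ʳ x) ∉ S

Invertible : {n : ℕ} → List (Subset n) → Set
Invertible {n} Ss = Σ (Permutation′ n) λ π → All (MapsIntoComplement π) Ss

-- K = {1, ..., c} as a subset of V = {1,...,n}, encoded 0-based:
-- Fin element x (representing x+1) lies in K iff toℕ x < c.
initialSegment : (n c : ℕ) → Subset n
initialSegment n c = tabulate (λ x → toℕ x <ᵇ c)

-- Let c = n/2 − k = ∣K∣ and U = Rᵢ ∪ Rⱼ ∪ Rₗ. A permutation π inverting the three sets
-- K ∪ R must send K outside all of them, so K, π(K) and U are pairwise disjoint and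
-- 2c + ∣U∣ ≤ n = 2c + 2k, i.e. ∣U∣ ≤ 2k. But three k-sets whose pairwise intersections
-- have fewer than k/3 elements cover, by the Bonferroni inequality, more than
-- 3k − k = 2k points.
module Submission where

open import Defs
open import Data.Nat using (ℕ; _*_; _∸_; _≤_; _<_)
open import Data.Fin using (Fin)
open import Data.Fin.Subset using (Subset; _∩_; _∪_; _⊆_; ∁; ∣_∣)
open import Data.List using (_∷_; [])
open import Relation.Binary.PropositionalEquality using (_≡_; _≢_)
open import Relation.Nullary using (¬_)

import Algebra.Properties.CommutativeMonoid.Sum as Sum
open import Data.Bool using (Bool; true; false)
open import Data.Fin.Permutation using (Permutation′; _⟨$⟩ˡ_; inverseʳ; flip)
open import Data.Fin.Subset using (_∈_; _∉_; inside; outside; ⊥)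
open import Data.Fin.Subset.Properties
open import Data.List.Relation.Unary.All using (_∷_; [])
open import Data.Nat using (zero; suc; _+_; z≤n; s≤s)
open import Data.Nat.Properties
open import Data.Nat.Tactic.RingSolver using (solve-∀)
open import Data.Product using (_,_)
open import Data.Sum using ([_,_])
open import Data.Vec using (_∷_; []; lookup; tabulate)
open import Data.Vec.Properties using (lookup∘tabulate; []=⇒lookup; lookup⇒[]=)
open import Function using (_∘_)
open import Relation.Binary.PropositionalEquality using (refl; sym; trans; cong; cong₂; subst; module ≡-Reasoning)

open Sum +-0-commutativeMonoid using (sum; sum-cong-≗; sum-permute)

private
  variable
    n : ℕ

indicator : Bool → ℕ
indicator true  = 1
indicator false = 0

∣p∣≡∑indicator : (p : Subset n) → ∣ p ∣ ≡ sum (indicator ∘ lookup p)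
∣p∣≡∑indicator []            = refl
∣p∣≡∑indicator (inside  ∷ p) = cong suc (∣p∣≡∑indicator p)
∣p∣≡∑indicator (outside ∷ p) = ∣p∣≡∑indicator p

image : Permutation′ n → Subset n → Subset n
image π p = tabulate (lookup p ∘ (π ⟨$⟩ˡ_))

∣image∣≡∣p∣ : (π : Permutation′ n) (p : Subset n) → ∣ image π p ∣ ≡ ∣ p ∣
∣image∣≡∣p∣ π p = begin
  ∣ image π p ∣                              ≡⟨ ∣p∣≡∑indicator (image π p) ⟩
  sum (indicator ∘ lookup (image π p))       ≡⟨ sum-cong-≗ (cong indicator ∘ lookup∘tabulate (lookup p ∘ (π ⟨$⟩ˡ_))) ⟩
  sum (indicator ∘ lookup p ∘ (π ⟨$⟩ˡ_))     ≡⟨ sum-permute (indicator ∘ lookup p) (flip π) ⟨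
  sum (indicator ∘ lookup p)                 ≡⟨ ∣p∣≡∑indicator p ⟨
  ∣ p ∣                                      ∎
  where open ≡-Reasoning

x∈image⁻ : (π : Permutation′ n) (p : Subset n) {y : Fin n} → y ∈ image π p → π ⟨$⟩ˡ y ∈ p
x∈image⁻ π p {y} y∈πp = lookup⇒[]= _ p (trans (sym (lookup∘tabulate _ y)) ([]=⇒lookup y∈πp))

image⊆∁ : (π : Permutation′ n) {p S : Subset n} →
  MapsIntoComplement π S → p ⊆ S → image π p ⊆ ∁ S
image⊆∁ π {p} {S} πS⊆∁S p⊆S {y} y∈πp =
  x∉p⇒x∈∁p (subst (_∉ S) (inverseʳ π) (πS⊆∁S _ (p⊆S (x∈image⁻ π p y∈πp))))

x∉p∪q⁺ : {p q : Subset n} {x : Fin n} → x ∉ p → x ∉ q → x ∉ p ∪ q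
x∉p∪q⁺ {p = p} {q} x∉p x∉q = [ x∉p , x∉q ] ∘ x∈p∪q⁻ p q

p⊆r∧q⊆r⇒p∪q⊆r : {p q r : Subset n} → p ⊆ r → q ⊆ r → p ∪ q ⊆ r
p⊆r∧q⊆r⇒p∪q⊆r {p = p} {q} p⊆r q⊆r = [ p⊆r , q⊆r ] ∘ x∈p∪q⁻ p q

∣p∪q∣+∣p∩q∣≡∣p∣+∣q∣ : (p q : Subset n) → ∣ p ∪ q ∣ + ∣ p ∩ q ∣ ≡ ∣ p ∣ + ∣ q ∣
∣p∪q∣+∣p∩q∣≡∣p∣+∣q∣ []            []            = refl
∣p∪q∣+∣p∩q∣≡∣p∣+∣q∣ (inside  ∷ p) (inside  ∷ q) =
  cong suc (trans (+-suc _ _) (trans (cong suc (∣p∪q∣+∣p∩q∣≡∣p∣+∣q∣ p q)) (sym (+-suc _ _))))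
∣p∪q∣+∣p∩q∣≡∣p∣+∣q∣ (inside  ∷ p) (outside ∷ q) = cong suc (∣p∪q∣+∣p∩q∣≡∣p∣+∣q∣ p q)
∣p∪q∣+∣p∩q∣≡∣p∣+∣q∣ (outside ∷ p) (inside  ∷ q) =
  trans (cong suc (∣p∪q∣+∣p∩q∣≡∣p∣+∣q∣ p q)) (sym (+-suc _ _))
∣p∪q∣+∣p∩q∣≡∣p∣+∣q∣ (outside ∷ p) (outside ∷ q) = ∣p∪q∣+∣p∩q∣≡∣p∣+∣q∣ p q

∣p∪q∣≤∣p∣+∣q∣ : (p q : Subset n) → ∣ p ∪ q ∣ ≤ ∣ p ∣ + ∣ q ∣
∣p∪q∣≤∣p∣+∣q∣ p q = subst (∣ p ∪ q ∣ ≤_) (∣p∪q∣+∣p∩q∣≡∣p∣+∣q∣ p q) (m≤m+n _ _)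

q⊆∁p⇒∣p∪q∣≡∣p∣+∣q∣ : (p q : Subset n) → q ⊆ ∁ p → ∣ p ∪ q ∣ ≡ ∣ p ∣ + ∣ q ∣
q⊆∁p⇒∣p∪q∣≡∣p∣+∣q∣ {n} p q q⊆∁p = begin
  ∣ p ∪ q ∣               ≡⟨ +-identityʳ _ ⟨
  ∣ p ∪ q ∣ + 0           ≡⟨ cong (∣ p ∪ q ∣ +_) (trans (cong ∣_∣ p∩q≡⊥) (∣⊥∣≡0 n)) ⟨
  ∣ p ∪ q ∣ + ∣ p ∩ q ∣   ≡⟨ ∣p∪q∣+∣p∩q∣≡∣p∣+∣q∣ p q ⟩
  ∣ p ∣ + ∣ q ∣           ∎
  where
  open ≡-Reasoning
  p∩q≡⊥ : p ∩ q ≡ ⊥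
  p∩q≡⊥ = Empty-unique λ where
    (_ , x∈p∩q) → let x∈p , x∈q = x∈p∩q⁻ p q x∈p∩q in x∈∁p⇒x∉p (q⊆∁p x∈q) x∈p

∣∁p∣+∣p∣≡n : (p : Subset n) → ∣ ∁ p ∣ + ∣ p ∣ ≡ n
∣∁p∣+∣p∣≡n p = trans (cong (_+ ∣ p ∣) (∣∁p∣≡n∸∣p∣ p)) (m∸n+n≡m (∣p∣≤n p))

∣p∣+∣q∣+∣r∣≤∣p∪q∪r∣+∣p∩q∣+∣p∩r∣+∣q∩r∣ : (p q r : Subset n) →
  ∣ p ∣ + ∣ q ∣ + ∣ r ∣ ≤ ∣ p ∪ q ∪ r ∣ + (∣ p ∩ q ∣ + ∣ p ∩ r ∣ + ∣ q ∩ r ∣)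
∣p∣+∣q∣+∣r∣≤∣p∪q∪r∣+∣p∩q∣+∣p∩r∣+∣q∩r∣ p q r = begin
  ∣ p ∣ + ∣ q ∣ + ∣ r ∣
    ≡⟨ +-assoc (∣ p ∣) (∣ q ∣) (∣ r ∣) ⟩
  ∣ p ∣ + (∣ q ∣ + ∣ r ∣)
    ≡⟨ cong (∣ p ∣ +_) (∣p∪q∣+∣p∩q∣≡∣p∣+∣q∣ q r) ⟨
  ∣ p ∣ + (∣ q ∪ r ∣ + ∣ q ∩ r ∣)
    ≡⟨ +-assoc (∣ p ∣) (∣ q ∪ r ∣) (∣ q ∩ r ∣) ⟨
  ∣ p ∣ + ∣ q ∪ r ∣ + ∣ q ∩ r ∣
    ≡⟨ cong (_+ ∣ q ∩ r ∣) (∣p∪q∣+∣p∩q∣≡∣p∣+∣q∣ p (q ∪ r)) ⟨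
  ∣ p ∪ q ∪ r ∣ + ∣ p ∩ (q ∪ r) ∣ + ∣ q ∩ r ∣
    ≡⟨ cong (λ s → ∣ p ∪ q ∪ r ∣ + ∣ s ∣ + ∣ q ∩ r ∣) (∩-distribˡ-∪ p q r) ⟩
  ∣ p ∪ q ∪ r ∣ + ∣ (p ∩ q) ∪ (p ∩ r) ∣ + ∣ q ∩ r ∣
    ≤⟨ +-monoˡ-≤ (∣ q ∩ r ∣) (+-monoʳ-≤ (∣ p ∪ q ∪ r ∣) (∣p∪q∣≤∣p∣+∣q∣ (p ∩ q) (p ∩ r))) ⟩
  ∣ p ∪ q ∪ r ∣ + (∣ p ∩ q ∣ + ∣ p ∩ r ∣) + ∣ q ∩ r ∣
    ≡⟨ +-assoc (∣ p ∪ q ∪ r ∣) (∣ p ∩ q ∣ + ∣ p ∩ r ∣) (∣ q ∩ r ∣) ⟩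
  ∣ p ∪ q ∪ r ∣ + (∣ p ∩ q ∣ + ∣ p ∩ r ∣ + ∣ q ∩ r ∣)
    ∎
  where open ≤-Reasoning

invertible⇒2∣K∣+∣R₁∪R₂∪R₃∣≤n : (K R₁ R₂ R₃ : Subset n) → R₁ ⊆ ∁ K → R₂ ⊆ ∁ K → R₃ ⊆ ∁ K →
  Invertible (K ∪ R₁ ∷ K ∪ R₂ ∷ K ∪ R₃ ∷ []) → 2 * ∣ K ∣ + ∣ R₁ ∪ R₂ ∪ R₃ ∣ ≤ n
invertible⇒2∣K∣+∣R₁∪R₂∪R₃∣≤n {n} K R₁ R₂ R₃ R₁⊆∁K R₂⊆∁K R₃⊆∁K (π , π₁ ∷ π₂ ∷ π₃ ∷ []) = begin
  2 * ∣ K ∣ + ∣ U ∣            ≡⟨ cong (λ t → ∣ K ∣ + t + ∣ U ∣) (+-identityʳ (∣ K ∣)) ⟩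
  ∣ K ∣ + ∣ K ∣ + ∣ U ∣        ≡⟨ +-assoc (∣ K ∣) (∣ K ∣) (∣ U ∣) ⟩
  ∣ K ∣ + (∣ K ∣ + ∣ U ∣)      ≡⟨ cong₂ _+_ (∣image∣≡∣p∣ π K) (q⊆∁p⇒∣p∪q∣≡∣p∣+∣q∣ K U U⊆∁K) ⟨
  ∣ image π K ∣ + ∣ K ∪ U ∣    ≤⟨ +-monoˡ-≤ (∣ K ∪ U ∣) (p⊆q⇒∣p∣≤∣q∣ πK⊆∁[K∪U]) ⟩
  ∣ ∁ (K ∪ U) ∣ + ∣ K ∪ U ∣    ≡⟨ ∣∁p∣+∣p∣≡n (K ∪ U) ⟩
  n                            ∎
  where
  open ≤-Reasoning
  U : Subset n
  U = R₁ ∪ R₂ ∪ R₃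
  U⊆∁K : U ⊆ ∁ K
  U⊆∁K = p⊆r∧q⊆r⇒p∪q⊆r R₁⊆∁K (p⊆r∧q⊆r⇒p∪q⊆r R₂⊆∁K R₃⊆∁K)
  πK⊆∁[K∪U] : image π K ⊆ ∁ (K ∪ U)
  πK⊆∁[K∪U] {y} y∈πK = x∉p⇒x∈∁p
    (x∉p∪q⁺ (λ y∈K → avoids π₁ (p⊆p∪q R₁ y∈K))
      (x∉p∪q⁺ (avoidsR π₁) (x∉p∪q⁺ (avoidsR π₂) (avoidsR π₃))))
    where
    avoids : ∀ {R} → MapsIntoComplement π (K ∪ R) → y ∉ K ∪ R
    avoids {R} πR = x∈∁p⇒x∉p (image⊆∁ π πR (p⊆p∪q R) y∈πK)
    avoidsR : ∀ {R} → MapsIntoComplement π (K ∪ R) → y ∉ R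
    avoidsR {R} πR y∈R = avoids πR (q⊆p∪q K R y∈R)

2k<∣p∪q∪r∣ : {k : ℕ} (p q r : Subset n) → ∣ p ∣ ≡ k → ∣ q ∣ ≡ k → ∣ r ∣ ≡ k →
  3 * ∣ p ∩ q ∣ < k → 3 * ∣ p ∩ r ∣ < k → 3 * ∣ q ∩ r ∣ < k → 2 * k < ∣ p ∪ q ∪ r ∣
2k<∣p∪q∪r∣ {k = k} p q r ∣p∣≡k ∣q∣≡k ∣r∣≡k 3a<k 3b<k 3c<k =
  +-cancelʳ-< s (2 * k) (∣ p ∪ q ∪ r ∣) (begin-strict
    2 * k + s                  <⟨ +-monoʳ-< (2 * k) s<k ⟩
    2 * k + k                  ≡⟨ +-comm (2 * k) k ⟩
    3 * k                      ≡⟨ 3*x≡x+x+x k ⟩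
    k + k + k                  ≡⟨ cong₂ _+_ (cong₂ _+_ ∣p∣≡k ∣q∣≡k) ∣r∣≡k ⟨
    ∣ p ∣ + ∣ q ∣ + ∣ r ∣      ≤⟨ ∣p∣+∣q∣+∣r∣≤∣p∪q∪r∣+∣p∩q∣+∣p∩r∣+∣q∩r∣ p q r ⟩
    ∣ p ∪ q ∪ r ∣ + s          ∎)
  where
  open ≤-Reasoning
  3*x≡x+x+x : ∀ x → 3 * x ≡ x + x + x
  3*x≡x+x+x = solve-∀
  s : ℕ
  s = ∣ p ∩ q ∣ + ∣ p ∩ r ∣ + ∣ q ∩ r ∣
  s<k : s < k
  s<k = *-cancelˡ-< 3 s k (begin-strict
    3 * s                                          ≡⟨ *-distribˡ-+ 3 (∣ p ∩ q ∣ + ∣ p ∩ r ∣) (∣ q ∩ r ∣) ⟩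
    3 * (∣ p ∩ q ∣ + ∣ p ∩ r ∣) + 3 * ∣ q ∩ r ∣    ≡⟨ cong (_+ 3 * ∣ q ∩ r ∣) (*-distribˡ-+ 3 (∣ p ∩ q ∣) (∣ p ∩ r ∣)) ⟩
    3 * ∣ p ∩ q ∣ + 3 * ∣ p ∩ r ∣ + 3 * ∣ q ∩ r ∣  <⟨ +-mono-< (+-mono-< 3a<k 3b<k) 3c<k ⟩
    k + k + k                                      ≡⟨ 3*x≡x+x+x k ⟨
    3 * k                                          ∎)

∣initialSegment∣≡c : ∀ n c → c ≤ n → ∣ initialSegment n c ∣ ≡ c
∣initialSegment∣≡c zero    zero    z≤n       = refl
∣initialSegment∣≡c (suc n) zero    z≤n       = ∣initialSegment∣≡c n zero z≤n
∣initialSegment∣≡c (suc n) (suc c) (s≤s c≤n) = cong suc (∣initialSegment∣≡c n c c≤n)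

lemma2p3 : (m k p : ℕ) → 1 ≤ k → k < m →
    (R : Fin p → Subset (2 * m)) →
    (∀ i → R i ⊆ ∁ (initialSegment (2 * m) (m ∸ k))) →
    (∀ i → ∣ R i ∣ ≡ k) →
    (∀ i j → i ≢ j → 3 * ∣ R i ∩ R j ∣ < k) →
    (i j l : Fin p) → i ≢ j → i ≢ l → j ≢ l →
    ¬ Invertible (initialSegment (2 * m) (m ∸ k) ∪ R i
                  ∷ initialSegment (2 * m) (m ∸ k) ∪ R j
                  ∷ initialSegment (2 * m) (m ∸ k) ∪ R l ∷ [])
lemma2p3 m k p _ k<m R R⊆∁K ∣R∣≡k 3∣R∩R∣<k i j l i≢j i≢l j≢l invertible =
  <⇒≱ 2m<2∣K∣+∣U∣ (invertible⇒2∣K∣+∣R₁∪R₂∪R₃∣≤n K (R i) (R j) (R l) (R⊆∁K i) (R⊆∁K j) (R⊆∁K l) invertible)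
  where
  open ≤-Reasoning
  K : Subset (2 * m)
  K = initialSegment (2 * m) (m ∸ k)
  ∣K∣≡m∸k : ∣ K ∣ ≡ m ∸ k
  ∣K∣≡m∸k = ∣initialSegment∣≡c (2 * m) (m ∸ k) (≤-trans (m∸n≤m m k) (m≤n*m m 2))
  U : Subset (2 * m)
  U = R i ∪ R j ∪ R l
  2k<∣U∣ : 2 * k < ∣ U ∣
  2k<∣U∣ = 2k<∣p∪q∪r∣ (R i) (R j) (R l) (∣R∣≡k i) (∣R∣≡k j) (∣R∣≡k l)
    (3∣R∩R∣<k i j i≢j) (3∣R∩R∣<k i l i≢l) (3∣R∩R∣<k j l j≢l)
  2m<2∣K∣+∣U∣ : 2 * m < 2 * ∣ K ∣ + ∣ U ∣
  2m<2∣K∣+∣U∣ = begin-strict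
    2 * m                 ≡⟨ cong (2 *_) (m∸n+n≡m (<⇒≤ k<m)) ⟨
    2 * (m ∸ k + k)       ≡⟨ *-distribˡ-+ 2 (m ∸ k) k ⟩
    2 * (m ∸ k) + 2 * k   <⟨ +-monoʳ-< (2 * (m ∸ k)) 2k<∣U∣ ⟩
    2 * (m ∸ k) + ∣ U ∣   ≡⟨ cong (λ c → 2 * c + ∣ U ∣) ∣K∣≡m∸k ⟨
    2 * ∣ K ∣ + ∣ U ∣     ∎
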